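{- For every $\ell\in\mathbb{Z}$, $$S_\ell(\tau)=\sum_{s\equiv\ell \ (\mathrm{mod}\ 2)}\ \sum_{r\ge s}(-1)^rq^{P(r,s)},\qquad P(r,s):=\tfrac12\big(r+\tfrac12\big)^2-\tfrac14s^2,$$ where $s$ and $r$ range over integers.
   Context: $q=e^{2\pi i\tau}$, $\tau\in\mathbb{H}$, $q^x:=e^{2\pi ix\tau}$. For $\ell\in\mathbb{Z}$, $S_\ell(\tau):=\Big(\sum_{m,n\ge0}-\sum_{m,n<0}\Big)(-1)^{m+\ell}q^{\frac12(m+2n-\ell+\frac12)^2-(n-\frac12\ell)^2}$ (sums over integers $m,n$). -}

module Defs where

open import Data.Nat as ℕ using (ℕ; suc; _%_)
open import Data.Integer using (ℤ; +_; -_; _+_; _-_; _*_; ∣_∣; _≤?_; _<?_; _≟_; 0ℤ; 1ℤ)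
open import Data.List using (List; map; upTo; foldr)
open import Data.Bool using (Bool; if_then_else_; _∧_)
open import Relation.Nullary.Decidable using (⌊_⌋)

-- We work with formal q-series in q^(1/8): all exponents occurring are in (1/8)ℤ.
-- A term q^x is recorded by the integer 8x.

range : ℕ → List ℤ
range K = map (λ i → + i - + K) (upTo (suc (K ℕ.+ K)))

boxSum : ℕ → (ℤ → ℤ → ℤ) → ℤ
boxSum K f = foldr (λ a acc → foldr (λ b acc' → f a b + acc') acc (range K)) 0ℤ (range K)

sgn : ℤ → ℤ
sgn k with ∣ k ∣ % 2
... | 0 = 1ℤ
... | _ = - 1ℤ

[_≡ᶻ_] : ℤ → ℤ → ℤ
[ x ≡ᶻ y ] = if ⌊ x ≟ y ⌋ then 1ℤ else 0ℤ

sq : ℤ → ℤ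
sq x = x * x

-- 8 · ( ½(m+2n-ℓ+½)² - (n-½ℓ)² )
lhsExp8 : ℤ → ℤ → ℤ → ℤ
lhsExp8 ℓ m n = sq (+ 2 * m + + 4 * n - + 2 * ℓ + 1ℤ) - + 2 * sq (+ 2 * n - ℓ)

-- 8 · P(r,s) = 8 · ( ½(r+½)² - ¼s² )
P8 : ℤ → ℤ → ℤ
P8 r s = sq (+ 2 * r + 1ℤ) - + 2 * sq s

-- contribution of (m,n) to the coefficient of q^(N/8) in S_ℓ:
-- (Σ_{m,n≥0} - Σ_{m,n<0}) (-1)^(m+ℓ) q^(...)
lhsTerm : ℤ → ℤ → ℤ → ℤ → ℤ
lhsTerm ℓ N m n =
  if ⌊ 0ℤ ≤? m ⌋ ∧ ⌊ 0ℤ ≤? n ⌋ then sgn (m + ℓ) * [ lhsExp8 ℓ m n ≡ᶻ N ]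
  else if ⌊ m <? 0ℤ ⌋ ∧ ⌊ n <? 0ℤ ⌋ then - (sgn (m + ℓ) * [ lhsExp8 ℓ m n ≡ᶻ N ])
  else 0ℤ

-- contribution of (r,s) to the coefficient of q^(N/8) in
-- Σ_{s ≡ ℓ (mod 2)} Σ_{r ≥ s} (-1)^r q^P(r,s),
-- with the standard convention Σ_{r ≥ s} := - Σ_{r < s} when s < 0.
rhsTerm : ℤ → ℤ → ℤ → ℤ → ℤ
rhsTerm ℓ N r s =
  if ⌊ ∣ s - ℓ ∣ % 2 ℕ.≟ 0 ⌋ then
    (if ⌊ 0ℤ ≤? s ⌋ then
       (if ⌊ s ≤? r ⌋ then sgn r * [ P8 r s ≡ᶻ N ] else 0ℤ)
     else
       (if ⌊ r <? s ⌋ then - (sgn r * [ P8 r s ≡ᶻ N ]) else 0ℤ))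
  else 0ℤ

lhsCoeff : ℕ → ℤ → ℤ → ℤ
lhsCoeff K ℓ N = boxSum K (lhsTerm ℓ N)

rhsCoeff : ℕ → ℤ → ℤ → ℤ
rhsCoeff K ℓ N = boxSum K (rhsTerm ℓ N)

{-# OPTIONS --safe #-}
-- Put s = 2n - ℓ and r = m + s. Then the (m,n) term of S_ℓ becomes (-1)^r q^P(r,s), and the conditions
-- "m, n ≥ 0" and "m, n < 0" become "r ≥ s, n ≥ 0" and "r < s, n < 0". So for every s ≡ ℓ (mod 2) both sides
-- contain the row sum Σ_{r≥s} (-1)^r q^P(r,s), except that it is written as -Σ_{r<s} when n < 0 on the left
-- and when s < 0 on the right. The two forms agree because r ↦ -1-r fixes P(r,s) and flips (-1)^r, so the
-- complete row Σ_r (-1)^r q^P(r,s) vanishes.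
-- Coefficientwise every sum is finite: q^(N/8) occurs in row s only for ∣r∣ ≤ ∣s∣ + ∣N∣, and 8P(r,s) > r for
-- 0 ≤ s ≤ r confines the row sums to ∣s∣ ≤ ∣N∣. Hence the box truncations stabilise, and the rearrangements
-- above (interchanging sums, translating r by s, splitting s by parity) hold on large enough windows.

module Submission where

open import Defs
open import Data.Nat as ℕ using (ℕ; zero; suc; s≤s; z≤n)
import Data.Nat.Properties as ℕP
import Data.Nat.DivMod as ℕD
import Data.Nat.Tactic.RingSolver as ℕ-Solver
open import Data.Integer as ℤ
  using (ℤ; +_; -[1+_]; -_; _+_; _-_; _*_; ∣_∣; _≤_; _<_; _≤?_; _<?_; 0ℤ; 1ℤ; +≤+; +<+; -≤+; -<+; -<-)
import Data.Integer.Properties as ℤP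
open import Data.Integer.DivMod using (_%ℕ_; _/ℕ_; n%ℕd<d; a≡a%ℕn+[a/ℕn]*n)
open import Data.Integer.Tactic.RingSolver using (solve-∀)
open import Data.List using (List; []; _∷_; _∷ʳ_; foldr; applyUpTo)
open import Data.List.Properties using (map-upTo; applyUpTo-∷ʳ)
open import Data.Bool using (Bool; true; false; if_then_else_)
open import Data.Product using (∃; _×_; _,_; proj₁; proj₂)
open import Data.Empty using (⊥-elim)
open import Function using (_∘_)
open import Relation.Nullary using (yes; no)
open import Relation.Nullary.Decidable using (⌊_⌋)
open import Relation.Binary.PropositionalEquality

-- Finite sums and the windows [-K, K]

∑ : List ℤ → (ℤ → ℤ) → ℤ
∑ xs g = foldr (λ x acc → g x + acc) 0ℤ xs

syntax ∑ xs (λ x → e) = ∑[ x ∈ xs ] e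

∑-cong : ∀ xs {g h : ℤ → ℤ} → (∀ x → g x ≡ h x) → ∑ xs g ≡ ∑ xs h
∑-cong []       g≗h = refl
∑-cong (x ∷ xs) g≗h = cong₂ _+_ (g≗h x) (∑-cong xs g≗h)

∑-zero : ∀ xs {g : ℤ → ℤ} → (∀ x → g x ≡ 0ℤ) → ∑ xs g ≡ 0ℤ
∑-zero []       g≗0 = refl
∑-zero (x ∷ xs) g≗0 = cong₂ _+_ (g≗0 x) (∑-zero xs g≗0)

∑-+ : ∀ xs (g h : ℤ → ℤ) → ∑[ x ∈ xs ] (g x + h x) ≡ ∑ xs g + ∑ xs h
∑-+ []       g h = refl
∑-+ (x ∷ xs) g h = begin
  g x + h x + ∑[ y ∈ xs ] (g y + h y)   ≡⟨ cong (_+_ (g x + h x)) (∑-+ xs g h) ⟩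
  g x + h x + (∑ xs g + ∑ xs h)         ≡⟨ shuffle (g x) (h x) (∑ xs g) (∑ xs h) ⟩
  g x + ∑ xs g + (h x + ∑ xs h)         ∎
  where
  open ≡-Reasoning
  shuffle : ∀ a b c d → a + b + (c + d) ≡ a + c + (b + d)
  shuffle = solve-∀

∑-comm : ∀ xs ys (f : ℤ → ℤ → ℤ) →
         ∑[ a ∈ xs ] ∑ ys (f a) ≡ ∑[ b ∈ ys ] ∑[ a ∈ xs ] f a b
∑-comm []       ys f = sym (∑-zero ys (λ _ → refl))
∑-comm (x ∷ xs) ys f = begin
  ∑ ys (f x) + ∑[ a ∈ xs ] ∑ ys (f a)          ≡⟨ cong (_+_ (∑ ys (f x))) (∑-comm xs ys f) ⟩
  ∑ ys (f x) + ∑[ b ∈ ys ] ∑[ a ∈ xs ] f a b   ≡⟨ ∑-+ ys (f x) (λ b → ∑[ a ∈ xs ] f a b) ⟨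
  ∑[ b ∈ ys ] (f x b + ∑[ a ∈ xs ] f a b)      ∎
  where open ≡-Reasoning

∑-∷ʳ : ∀ xs y (g : ℤ → ℤ) → ∑ (xs ∷ʳ y) g ≡ ∑ xs g + g y
∑-∷ʳ []       y g = ℤP.+-comm (g y) 0ℤ
∑-∷ʳ (x ∷ xs) y g = trans (cong (_+_ (g x)) (∑-∷ʳ xs y g)) (sym (ℤP.+-assoc (g x) _ _))

∑-applyUpTo-cong : ∀ n {f f′ : ℕ → ℤ} (g : ℤ → ℤ) → (∀ i → f i ≡ f′ i) →
                   ∑ (applyUpTo f n) g ≡ ∑ (applyUpTo f′ n) g
∑-applyUpTo-cong zero    g f≗f′ = refl
∑-applyUpTo-cong (suc n) g f≗f′ =
  cong₂ _+_ (cong g (f≗f′ 0)) (∑-applyUpTo-cong n g (f≗f′ ∘ suc))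

∑-applyUpTo-suc : ∀ n (f : ℕ → ℤ) (g : ℤ → ℤ) →
                  ∑ (applyUpTo f (suc n)) g ≡ ∑ (applyUpTo f n) g + g (f n)
∑-applyUpTo-suc n f g =
  trans (cong (λ xs → ∑ xs g) (sym (applyUpTo-∷ʳ f n))) (∑-∷ʳ (applyUpTo f n) (f n) g)

boxSum≡∑∑ : ∀ K f → boxSum K f ≡ ∑[ a ∈ range K ] ∑ (range K) (f a)
boxSum≡∑∑ K f = outer (range K)
  where
  inner : ∀ ys acc (h : ℤ → ℤ) → foldr (λ b acc′ → h b + acc′) acc ys ≡ ∑ ys h + acc
  inner []       acc h = sym (ℤP.+-identityˡ acc)
  inner (y ∷ ys) acc h = trans (cong (_+_ (h y)) (inner ys acc h)) (sym (ℤP.+-assoc (h y) _ _))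
  outer : ∀ xs → foldr (λ a acc → foldr (λ b acc′ → f a b + acc′) acc (range K)) 0ℤ xs
                 ≡ ∑[ a ∈ xs ] ∑ (range K) (f a)
  outer []       = refl
  outer (x ∷ xs) = trans (inner (range K) _ (f x)) (cong (_+_ (∑ (range K) (f x))) (outer xs))

∑-range-suc : ∀ K (g : ℤ → ℤ) →
              ∑ (range (suc K)) g ≡ g -[1+ K ] + (∑ (range K) g + g (+ suc K))
∑-range-suc K g = begin
  ∑ (range (suc K)) g
    ≡⟨ cong (λ xs → ∑ xs g) (map-upTo (at (suc K)) (suc (suc K ℕ.+ suc K))) ⟩
  g -[1+ K ] + ∑ (applyUpTo (at (suc K) ∘ suc) (suc (K ℕ.+ suc K))) g
    ≡⟨ cong (λ n → g -[1+ K ] + ∑ (applyUpTo (at (suc K) ∘ suc) (suc n)) g) (ℕP.+-suc K K) ⟩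
  g -[1+ K ] + ∑ (applyUpTo (at (suc K) ∘ suc) (suc (suc (K ℕ.+ K)))) g
    ≡⟨ cong (_+_ (g -[1+ K ])) (∑-applyUpTo-suc (suc (K ℕ.+ K)) (at (suc K) ∘ suc) g) ⟩
  g -[1+ K ] + (∑ (applyUpTo (at (suc K) ∘ suc) (suc (K ℕ.+ K))) g + g (at (suc K) (suc (suc (K ℕ.+ K)))))
    ≡⟨ cong₂ (λ s x → g -[1+ K ] + (s + g x))
         (trans (∑-applyUpTo-cong (suc (K ℕ.+ K)) g (λ i → at-suc i K))
                (cong (λ xs → ∑ xs g) (sym (map-upTo (at K) (suc (K ℕ.+ K))))))
         last ⟩
  g -[1+ K ] + (∑ (range K) g + g (+ suc K))
    ∎
  where
  open ≡-Reasoning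
  at : ℕ → ℕ → ℤ
  at K i = + i - + K
  at-suc : ∀ i K → at (suc K) (suc i) ≡ at K i
  at-suc i K = trans (ℤP.[1+m]⊖[1+n]≡m⊖n i K) (sym (ℤP.m-n≡m⊖n i K))
  last : at (suc K) (suc (suc (K ℕ.+ K))) ≡ + suc K
  last = trans (at-suc (suc (K ℕ.+ K)) K) (trans (cong (λ k → 1ℤ + k - + K) (ℤP.pos-+ K K)) (cancel (+ K)))
    where
    cancel : ∀ k → 1ℤ + (k + k) - k ≡ 1ℤ + k
    cancel = solve-∀

Supported : ℕ → (ℤ → ℤ) → Set
Supported B g = ∀ x → g x ≢ 0ℤ → ∣ x ∣ ℕ.≤ B

supported-vanish : ∀ {B g} → Supported B g → ∀ x → B ℕ.< ∣ x ∣ → g x ≡ 0ℤ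
supported-vanish {g = g} supp x B<∣x∣ with g x ℤ.≟ 0ℤ
... | yes gx≡0 = gx≡0
... | no  gx≢0 = ⊥-elim (ℕP.<⇒≱ B<∣x∣ (supp x gx≢0))

supported-neg : ∀ {B g} → Supported B g → Supported B (λ x → g (- x))
supported-neg supp x g-x≢0 = subst (ℕ._≤ _) (ℤP.∣-i∣≡∣i∣ x) (supp (- x) g-x≢0)

supported-shift : ∀ {B g} → Supported B g → ∀ a → Supported (B ℕ.+ ∣ a ∣) (λ x → g (x + a))
supported-shift supp a x gx+a≢0 =
  ℕP.≤-trans (ℕP.≤-reflexive (cong ∣_∣ (unshift x a)))
    (ℕP.≤-trans (ℤP.∣i+j∣≤∣i∣+∣j∣ (x + a) (- a))
      (ℕP.+-mono-≤ (supp (x + a) gx+a≢0) (ℕP.≤-reflexive (ℤP.∣-i∣≡∣i∣ a))))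
  where
  unshift : ∀ x a → x ≡ (x + a) + - a
  unshift = solve-∀

∑-range-stable : ∀ {B g} → Supported B g → ∀ {K} → B ℕ.≤ K → ∑ (range K) g ≡ ∑ (range B) g
∑-range-stable {B} {g} supp B≤K = go (ℕP.≤⇒≤′ B≤K)
  where
  go : ∀ {K} → B ℕ.≤′ K → ∑ (range K) g ≡ ∑ (range B) g
  go ℕ.≤′-refl = refl
  go (ℕ.≤′-step {K} B≤′K) = begin
    ∑ (range (suc K)) g                          ≡⟨ ∑-range-suc K g ⟩
    g -[1+ K ] + (∑ (range K) g + g (+ suc K))   ≡⟨ cong₂ (λ a b → a + (∑ (range K) g + b))
                                                      (supported-vanish supp _ B<1+K)
                                                      (supported-vanish supp _ B<1+K) ⟩
    0ℤ + (∑ (range K) g + 0ℤ)                    ≡⟨ trans (ℤP.+-identityˡ _) (ℤP.+-identityʳ _) ⟩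
    ∑ (range K) g                                ≡⟨ go B≤′K ⟩
    ∑ (range B) g                                ∎
    where
    open ≡-Reasoning
    B<1+K : B ℕ.< suc K
    B<1+K = ℕ.s≤s (ℕP.≤′⇒≤ B≤′K)

∑-range-neg : ∀ K (g : ℤ → ℤ) → ∑[ x ∈ range K ] g (- x) ≡ ∑ (range K) g
∑-range-neg zero    g = refl
∑-range-neg (suc K) g = begin
  ∑[ x ∈ range (suc K) ] g (- x)
    ≡⟨ ∑-range-suc K (λ x → g (- x)) ⟩
  g (+ suc K) + (∑[ x ∈ range K ] g (- x) + g -[1+ K ])
    ≡⟨ cong (λ s → g (+ suc K) + (s + g -[1+ K ])) (∑-range-neg K g) ⟩
  g (+ suc K) + (∑ (range K) g + g -[1+ K ])
    ≡⟨ swap-ends (g (+ suc K)) (∑ (range K) g) (g -[1+ K ]) ⟩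
  g -[1+ K ] + (∑ (range K) g + g (+ suc K))
    ≡⟨ ∑-range-suc K g ⟨
  ∑ (range (suc K)) g
    ∎
  where
  open ≡-Reasoning
  swap-ends : ∀ a s b → a + (s + b) ≡ b + (s + a)
  swap-ends = solve-∀

∑-range-shift-one : ∀ K (g : ℤ → ℤ) →
                 ∑[ x ∈ range K ] g (1ℤ + x) + g (- + K) ≡ ∑ (range K) g + g (+ suc K)
∑-range-shift-one zero    g = rotate (g 1ℤ) (g 0ℤ)
  where
  rotate : ∀ a b → a + 0ℤ + b ≡ b + 0ℤ + a
  rotate = solve-∀
∑-range-shift-one (suc K) g = begin
  ∑[ x ∈ range (suc K) ] g (1ℤ + x) + g -[1+ K ]
    ≡⟨ cong (_+ g -[1+ K ]) (∑-range-suc K (λ x → g (1ℤ + x))) ⟩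
  g (1ℤ + -[1+ K ]) + (∑[ x ∈ range K ] g (1ℤ + x) + g (+ suc (suc K))) + g -[1+ K ]
    ≡⟨ cong (λ y → g y + (∑[ x ∈ range K ] g (1ℤ + x) + g (+ suc (suc K))) + g -[1+ K ])
            (1+-[1+k]≡-k (+ K)) ⟩
  g (- + K) + (∑[ x ∈ range K ] g (1ℤ + x) + g (+ suc (suc K))) + g -[1+ K ]
    ≡⟨ regroup (g (- + K)) (∑[ x ∈ range K ] g (1ℤ + x)) (g (+ suc (suc K))) (g -[1+ K ]) ⟩
  (∑[ x ∈ range K ] g (1ℤ + x) + g (- + K)) + (g (+ suc (suc K)) + g -[1+ K ])
    ≡⟨ cong (_+ (g (+ suc (suc K)) + g -[1+ K ])) (∑-range-shift-one K g) ⟩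
  (∑ (range K) g + g (+ suc K)) + (g (+ suc (suc K)) + g -[1+ K ])
    ≡⟨ regroup′ (∑ (range K) g) (g (+ suc K)) (g (+ suc (suc K))) (g -[1+ K ]) ⟩
  g -[1+ K ] + (∑ (range K) g + g (+ suc K)) + g (+ suc (suc K))
    ≡⟨ cong (_+ g (+ suc (suc K))) (∑-range-suc K g) ⟨
  ∑ (range (suc K)) g + g (+ suc (suc K))
    ∎
  where
  open ≡-Reasoning
  1+-[1+k]≡-k : ∀ k → 1ℤ + - (1ℤ + k) ≡ - k
  1+-[1+k]≡-k = solve-∀
  regroup : ∀ a s b c → a + (s + b) + c ≡ (s + a) + (b + c)
  regroup = solve-∀
  regroup′ : ∀ s a b c → (s + a) + (b + c) ≡ c + (s + a) + b
  regroup′ = solve-∀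

∑-range-shift : ∀ {B g} → Supported B g → ∀ a {K} → B ℕ.+ ∣ a ∣ ℕ.≤ K →
                ∑[ x ∈ range K ] g (x + a) ≡ ∑ (range K) g
∑-range-shift {B} {g} supp (+ k) = shift-pos supp k
  where
  shift-pos : ∀ {g} → Supported B g → ∀ k {K} → B ℕ.+ k ℕ.≤ K →
              ∑[ x ∈ range K ] g (x + + k) ≡ ∑ (range K) g
  shift-pos {g} supp zero    {K} _   = ∑-cong (range K) (λ x → cong g (ℤP.+-identityʳ x))
  shift-pos {g} supp (suc k) {K} B+1+k≤K = begin
    ∑[ x ∈ range K ] g (x + + suc k)                 ≡⟨ ∑-cong (range K) (λ x → cong g (reassoc x (+ k))) ⟩
    ∑[ x ∈ range K ] h (1ℤ + x)                      ≡⟨ telescoped ⟩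
    ∑ (range K) h                                    ≡⟨ shift-pos supp k (ℕP.<⇒≤ B+k<K) ⟩
    ∑ (range K) g                                    ∎
    where
    open ≡-Reasoning
    h : ℤ → ℤ
    h y = g (y + + k)
    reassoc : ∀ x k → x + (1ℤ + k) ≡ (1ℤ + x) + k
    reassoc = solve-∀
    h-supp : Supported (B ℕ.+ k) h
    h-supp = supported-shift supp (+ k)
    B+k<K : B ℕ.+ k ℕ.< K
    B+k<K = subst (ℕ._≤ K) (ℕP.+-suc B k) B+1+k≤K
    ∣-K∣≡K : ∣ - + K ∣ ≡ K
    ∣-K∣≡K = ℤP.∣-i∣≡∣i∣ (+ K)
    telescoped : ∑[ x ∈ range K ] h (1ℤ + x) ≡ ∑ (range K) h
    telescoped = begin
      ∑[ x ∈ range K ] h (1ℤ + x)           ≡⟨ ℤP.+-identityʳ _ ⟨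
      ∑[ x ∈ range K ] h (1ℤ + x) + 0ℤ      ≡⟨ cong (_+_ (∑[ x ∈ range K ] h (1ℤ + x)))
                                                    (supported-vanish h-supp (- + K) (subst (B ℕ.+ k ℕ.<_) (sym ∣-K∣≡K) B+k<K)) ⟨
      ∑[ x ∈ range K ] h (1ℤ + x) + h (- + K) ≡⟨ ∑-range-shift-one K h ⟩
      ∑ (range K) h + h (+ suc K)            ≡⟨ cong (_+_ (∑ (range K) h))
                                                    (supported-vanish h-supp (+ suc K) (ℕP.m<n⇒m<1+n B+k<K)) ⟩
      ∑ (range K) h + 0ℤ                     ≡⟨ ℤP.+-identityʳ _ ⟩
      ∑ (range K) h                          ∎
∑-range-shift {B} {g} supp -[1+ k ] {K} B+1+k≤K = begin
  ∑[ x ∈ range K ] g (x + -[1+ k ])         ≡⟨ ∑-range-neg K (λ x → g (x + -[1+ k ])) ⟨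
  ∑[ x ∈ range K ] g (- x + -[1+ k ])       ≡⟨ ∑-cong (range K) (λ x → cong g (neg-out x (+ k))) ⟩
  ∑[ x ∈ range K ] g (- (x + + suc k))      ≡⟨ ∑-range-shift (supported-neg supp) (+ suc k) B+1+k≤K ⟩
  ∑[ x ∈ range K ] g (- x)                  ≡⟨ ∑-range-neg K g ⟩
  ∑ (range K) g                             ∎
  where
  open ≡-Reasoning
  neg-out : ∀ x k → - x + - (1ℤ + k) ≡ - (x + (1ℤ + k))
  neg-out = solve-∀

∑-range-antisym : ∀ K (g : ℤ → ℤ) → (∀ x → g (- 1ℤ - x) ≡ - g x) → ∑ (range K) g ≡ g (+ K)
∑-range-antisym zero    g anti = ℤP.+-identityʳ (g 0ℤ)
∑-range-antisym (suc K) g anti = begin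
  ∑ (range (suc K)) g                            ≡⟨ ∑-range-suc K g ⟩
  g -[1+ K ] + (∑ (range K) g + g (+ suc K))     ≡⟨ cong₂ (λ a s → a + (s + g (+ suc K)))
                                                          g-[1+K] (∑-range-antisym K g anti) ⟩
  - g (+ K) + (g (+ K) + g (+ suc K))            ≡⟨ cancel (g (+ K)) (g (+ suc K)) ⟩
  g (+ suc K)                                    ∎
  where
  open ≡-Reasoning
  -1-k≡-[1+k] : ∀ k → - 1ℤ - k ≡ - (1ℤ + k)
  -1-k≡-[1+k] = solve-∀
  g-[1+K] : g -[1+ K ] ≡ - g (+ K)
  g-[1+K] = trans (cong g (sym (-1-k≡-[1+k] (+ K)))) (anti (+ K))
  cancel : ∀ a b → - a + (a + b) ≡ b
  cancel = solve-∀

∑-range-pairs : ∀ K (G : ℤ → ℤ) →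
                ∑ (range (suc (K ℕ.+ K))) G
                  ≡ G -[1+ K ℕ.+ K ] + ∑[ n ∈ range K ] (G (+ 2 * n) + G (+ 2 * n + 1ℤ))
∑-range-pairs zero    G = trans (∑-range-suc 0 G) (regroup (G -[1+ 0 ]) (G 0ℤ) (G 1ℤ))
  where
  regroup : ∀ a b c → a + (b + 0ℤ + c) ≡ a + (b + c + 0ℤ)
  regroup = solve-∀
∑-range-pairs (suc K) G = begin
  ∑ (range (suc (suc (K ℕ.+ suc K)))) G
    ≡⟨ cong (λ k → ∑ (range (suc (suc k))) G) (ℕP.+-suc K K) ⟩
  ∑ (range (suc (suc (suc M)))) G
    ≡⟨ ∑-range-suc (suc (suc M)) G ⟩
  G -[1+ suc (suc M) ] + (∑ (range (suc (suc M))) G + G (+ suc (suc (suc M))))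
    ≡⟨ cong (_+_ (G -[1+ suc (suc M) ])) inner ⟩
  G -[1+ suc (suc M) ] + (pair -[1+ K ] + (∑ (range K) pair + pair (+ suc K)))
    ≡⟨ cong (_+_ (G -[1+ suc (suc M) ])) (∑-range-suc K pair) ⟨
  G -[1+ suc (suc M) ] + ∑ (range (suc K)) pair
    ≡⟨ cong (λ k → G -[1+ suc k ] + ∑ (range (suc K)) pair) (ℕP.+-suc K K) ⟨
  G -[1+ suc (K ℕ.+ suc K) ] + ∑ (range (suc K)) pair
    ∎
  where
  open ≡-Reasoning
  M = K ℕ.+ K
  pair : ℤ → ℤ
  pair n = G (+ 2 * n) + G (+ 2 * n + 1ℤ)
  regroup : ∀ b e P c d → b + (e + P + c) + d ≡ (b + e) + (P + (c + d))
  regroup = solve-∀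
  neg-even : ∀ k → + 2 * - (1ℤ + k) ≡ - (1ℤ + (1ℤ + (k + k)))
  neg-even = solve-∀
  neg-odd : ∀ k → + 2 * - (1ℤ + k) + 1ℤ ≡ - (1ℤ + (k + k))
  neg-odd = solve-∀
  pos-even : ∀ k → + 2 * (1ℤ + k) ≡ 1ℤ + (1ℤ + (k + k))
  pos-even = solve-∀
  pos-odd : ∀ k → + 2 * (1ℤ + k) + 1ℤ ≡ 1ℤ + (1ℤ + (1ℤ + (k + k)))
  pos-odd = solve-∀
  inner : ∑ (range (suc (suc M))) G + G (+ suc (suc (suc M)))
          ≡ pair -[1+ K ] + (∑ (range K) pair + pair (+ suc K))
  inner = begin
    ∑ (range (suc (suc M))) G + G (+ suc (suc (suc M)))
      ≡⟨ cong (_+ G (+ suc (suc (suc M)))) (∑-range-suc (suc M) G) ⟩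
    G -[1+ suc M ] + (∑ (range (suc M)) G + G (+ suc (suc M))) + G (+ suc (suc (suc M)))
      ≡⟨ cong (λ x → G -[1+ suc M ] + (x + G (+ suc (suc M))) + G (+ suc (suc (suc M)))) (∑-range-pairs K G) ⟩
    G -[1+ suc M ] + (G -[1+ M ] + ∑ (range K) pair + G (+ suc (suc M))) + G (+ suc (suc (suc M)))
      ≡⟨ regroup (G -[1+ suc M ]) (G -[1+ M ]) (∑ (range K) pair) (G (+ suc (suc M))) (G (+ suc (suc (suc M)))) ⟩
    (G -[1+ suc M ] + G -[1+ M ]) + (∑ (range K) pair + (G (+ suc (suc M)) + G (+ suc (suc (suc M)))))
      ≡⟨ cong₂ (λ p q → p + (∑ (range K) pair + q))
               (cong₂ (λ x y → G x + G y) (sym (neg-even (+ K))) (sym (neg-odd (+ K))))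
               (cong₂ (λ x y → G x + G y) (sym (pos-even (+ K))) (sym (pos-odd (+ K)))) ⟩
    pair -[1+ K ] + (∑ (range K) pair + pair (+ suc K))
      ∎

∑-range-class : ∀ {B E} → Supported B E → ∀ ℓ → (∀ n → E (+ 2 * n - ℓ + 1ℤ) ≡ 0ℤ) →
                ∀ {K} → B ℕ.+ ∣ ℓ ∣ ℕ.≤ K ℕ.+ K → ∑[ n ∈ range K ] E (+ 2 * n - ℓ) ≡ ∑ (range B) E
∑-range-class {B} {E} supp ℓ off-class {K} B+∣ℓ∣≤2K = begin
  ∑[ n ∈ range K ] E (+ 2 * n - ℓ)                                  ≡⟨ ∑-cong (range K) pad ⟩
  ∑ (range K) pair                                                   ≡⟨ ℤP.+-identityˡ _ ⟨
  0ℤ + ∑ (range K) pair                                              ≡⟨ cong (_+ ∑ (range K) pair)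
                                                                          (supported-vanish (supported-shift supp (- ℓ))
                                                                             -[1+ K ℕ.+ K ] (ℕ.s≤s B+∣-ℓ∣≤2K)) ⟨
  E′ -[1+ K ℕ.+ K ] + ∑ (range K) pair                               ≡⟨ ∑-range-pairs K E′ ⟨
  ∑ (range (suc (K ℕ.+ K))) E′                                       ≡⟨ ∑-range-shift supp (- ℓ) (ℕP.m≤n⇒m≤1+n B+∣-ℓ∣≤2K) ⟩
  ∑ (range (suc (K ℕ.+ K))) E                                        ≡⟨ ∑-range-stable supp B≤1+2K ⟩
  ∑ (range B) E                                                      ∎
  where
  open ≡-Reasoning
  E′ : ℤ → ℤ
  E′ t = E (t - ℓ)
  pair : ℤ → ℤ
  pair n = E′ (+ 2 * n) + E′ (+ 2 * n + 1ℤ)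
  B+∣-ℓ∣≤2K : B ℕ.+ ∣ - ℓ ∣ ℕ.≤ K ℕ.+ K
  B+∣-ℓ∣≤2K = subst (λ a → B ℕ.+ a ℕ.≤ K ℕ.+ K) (sym (ℤP.∣-i∣≡∣i∣ ℓ)) B+∣ℓ∣≤2K
  B≤1+2K : B ℕ.≤ suc (K ℕ.+ K)
  B≤1+2K = ℕP.m≤n⇒m≤1+n (ℕP.≤-trans (ℕP.m≤m+n B ∣ ℓ ∣) B+∣ℓ∣≤2K)
  swap : ∀ n ℓ → + 2 * n + 1ℤ - ℓ ≡ + 2 * n - ℓ + 1ℤ
  swap = solve-∀
  pad : ∀ n → E (+ 2 * n - ℓ) ≡ pair n
  pad n = sym (trans (cong (_+_ (E′ (+ 2 * n))) (trans (cong E (swap n ℓ)) (off-class n)))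
                     (ℤP.+-identityʳ _))

-- Integer inequalities, parity and the sign (-1)^r

0≤+n : ∀ {n} → 0ℤ ≤ + n
0≤+n = +≤+ z≤n

0≤i*j : ∀ {i j} → 0ℤ ≤ i → 0ℤ ≤ j → 0ℤ ≤ i * j
0≤i*j {+ m} {+ n} _ _ = subst (0ℤ ≤_) (ℤP.pos-* m n) 0≤+n

i≤i+nonneg : ∀ i {j} → 0ℤ ≤ j → i ≤ i + j
i≤i+nonneg i 0≤j = subst (_≤ i + _) (ℤP.+-identityʳ i) (ℤP.+-monoʳ-≤ i 0≤j)

i≤+∣i∣ : ∀ i → i ≤ + ∣ i ∣
i≤+∣i∣ (+ n)    = ℤP.≤-refl
i≤+∣i∣ -[1+ n ] = -≤+

+n<i⇒n<∣i∣ : ∀ {n i} → + n < i → n ℕ.< ∣ i ∣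
+n<i⇒n<∣i∣ (+<+ n<m) = n<m

i<-n⇒n<∣i∣ : ∀ {n} i → i < - + n → n ℕ.< ∣ i ∣
i<-n⇒n<∣i∣ {n} i i<-n = subst (n ℕ.<_) (ℤP.∣-i∣≡∣i∣ i)
                          (+n<i⇒n<∣i∣ (subst (_< - i) (ℤP.neg-involutive (+ n)) (ℤP.neg-mono-< i<-n)))

∣i∣≤a+b : ∀ {a b} i → - + a ≤ i → i ≤ + b → ∣ i ∣ ℕ.≤ a ℕ.+ b
∣i∣≤a+b {a} (+ n) _ (+≤+ n≤b) = ℕP.m≤n⇒m≤o+n a n≤b
∣i∣≤a+b {a} {b} -[1+ n ] -a≤i _ =
  ℕP.m≤n⇒m≤n+o b (ℤP.drop‿+≤+ (subst (+ suc n ≤_) (ℤP.neg-involutive (+ a)) (ℤP.neg-mono-≤ -a≤i)))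

-∣i∣≤j-i : ∀ i {j} → 0ℤ ≤ j → - + ∣ i ∣ ≤ j - i
-∣i∣≤j-i i {j} 0≤j = ℤP.≤-trans (ℤP.neg-mono-≤ (i≤+∣i∣ i))
                                (subst (_≤ j - i) (ℤP.+-identityˡ (- i)) (ℤP.+-monoˡ-≤ (- i) 0≤j))

j-i≤∣i∣ : ∀ i {j} → j ≤ 0ℤ → j - i ≤ + ∣ i ∣
j-i≤∣i∣ i {j} j≤0 = ℤP.≤-trans (subst (j - i ≤_) (ℤP.+-identityˡ (- i)) (ℤP.+-monoˡ-≤ (- i) j≤0))
                               (subst (- i ≤_) (cong +_ (ℤP.∣-i∣≡∣i∣ i)) (i≤+∣i∣ (- i)))

-[1+n]+i<i : ∀ n i → -[1+ n ] + i < i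
-[1+n]+i<i n i = subst (-[1+ n ] + i <_) (ℤP.+-identityˡ i) (ℤP.+-monoˡ-< i -<+)

data Parity (x : ℤ) : Set where
  even : ∀ k → x ≡ + 2 * k → Parity x
  odd  : ∀ k → x ≡ + 2 * k + 1ℤ → Parity x

parity : ∀ x → Parity x
parity x with x %ℕ 2 | n%ℕd<d x 2 | a≡a%ℕn+[a/ℕn]*n x 2
... | 0           | _               | x≡ = even (x /ℕ 2) (trans x≡ (twice-even (x /ℕ 2)))
  where
  twice-even : ∀ q → 0ℤ + q * + 2 ≡ + 2 * q
  twice-even = solve-∀
... | 1           | _               | x≡ = odd (x /ℕ 2) (trans x≡ (twice-odd (x /ℕ 2)))
  where
  twice-odd : ∀ q → 1ℤ + q * + 2 ≡ + 2 * q + 1ℤ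
  twice-odd = solve-∀
... | suc (suc _) | s≤s (s≤s ())    | _

∣2k∣%2≡0 : ∀ k → ∣ + 2 * k ∣ ℕ.% 2 ≡ 0
∣2k∣%2≡0 k = trans (cong (ℕ._% 2) (trans (ℤP.abs-* (+ 2) k) (ℕP.*-comm 2 ∣ k ∣))) (ℕD.m*n%n≡0 ∣ k ∣ 2)

∣2k+1∣%2≡1 : ∀ k → ∣ + 2 * k + 1ℤ ∣ ℕ.% 2 ≡ 1
∣2k+1∣%2≡1 (+ j) = begin
  ∣ + 2 * + j + 1ℤ ∣ ℕ.% 2   ≡⟨ cong (λ z → ∣ z + 1ℤ ∣ ℕ.% 2) (sym (ℤP.pos-* 2 j)) ⟩
  (2 ℕ.* j ℕ.+ 1) ℕ.% 2      ≡⟨ cong (ℕ._% 2) (trans (ℕP.+-comm (2 ℕ.* j) 1) (cong suc (ℕP.*-comm 2 j))) ⟩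
  (1 ℕ.+ j ℕ.* 2) ℕ.% 2      ≡⟨ ℕD.[m+kn]%n≡m%n 1 j 2 ⟩
  1                          ∎
  where open ≡-Reasoning
∣2k+1∣%2≡1 -[1+ j ] = begin
  ∣ + 2 * -[1+ j ] + 1ℤ ∣ ℕ.% 2   ≡⟨ cong (λ z → ∣ z ∣ ℕ.% 2) (mirror (+ j)) ⟩
  ∣ - (+ 2 * + j + 1ℤ) ∣ ℕ.% 2    ≡⟨ cong (ℕ._% 2) (ℤP.∣-i∣≡∣i∣ (+ 2 * + j + 1ℤ)) ⟩
  ∣ + 2 * + j + 1ℤ ∣ ℕ.% 2        ≡⟨ ∣2k+1∣%2≡1 (+ j) ⟩
  1                               ∎
  where
  open ≡-Reasoning
  mirror : ∀ j → + 2 * - (1ℤ + j) + 1ℤ ≡ - (+ 2 * j + 1ℤ)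
  mirror = solve-∀

sgn-even : ∀ k → sgn (+ 2 * k) ≡ 1ℤ
sgn-even k rewrite ∣2k∣%2≡0 k = refl

sgn-odd : ∀ k → sgn (+ 2 * k + 1ℤ) ≡ - 1ℤ
sgn-odd k rewrite ∣2k+1∣%2≡1 k = refl

sgn-+2* : ∀ x y → sgn (x + + 2 * y) ≡ sgn x
sgn-+2* x y with parity x
... | even k refl = begin
  sgn (+ 2 * k + + 2 * y)   ≡⟨ cong sgn (collect k y) ⟩
  sgn (+ 2 * (k + y))       ≡⟨ trans (sgn-even (k + y)) (sym (sgn-even k)) ⟩
  sgn (+ 2 * k)             ∎
  where
  open ≡-Reasoning
  collect : ∀ k y → + 2 * k + + 2 * y ≡ + 2 * (k + y)
  collect = solve-∀
... | odd k refl = begin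
  sgn (+ 2 * k + 1ℤ + + 2 * y)   ≡⟨ cong sgn (collect k y) ⟩
  sgn (+ 2 * (k + y) + 1ℤ)       ≡⟨ trans (sgn-odd (k + y)) (sym (sgn-odd k)) ⟩
  sgn (+ 2 * k + 1ℤ)             ∎
  where
  open ≡-Reasoning
  collect : ∀ k y → + 2 * k + 1ℤ + + 2 * y ≡ + 2 * (k + y) + 1ℤ
  collect = solve-∀

sgn-reflect : ∀ x → sgn (- 1ℤ - x) ≡ - sgn x
sgn-reflect x with parity x
... | even k refl = begin
  sgn (- 1ℤ - + 2 * k)          ≡⟨ cong sgn (flip k) ⟩
  sgn (+ 2 * (- k - 1ℤ) + 1ℤ)   ≡⟨ sgn-odd (- k - 1ℤ) ⟩
  - 1ℤ                          ≡⟨ cong -_ (sgn-even k) ⟨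
  - sgn (+ 2 * k)               ∎
  where
  open ≡-Reasoning
  flip : ∀ k → - 1ℤ - + 2 * k ≡ + 2 * (- k - 1ℤ) + 1ℤ
  flip = solve-∀
... | odd k refl = begin
  sgn (- 1ℤ - (+ 2 * k + 1ℤ))   ≡⟨ cong sgn (flip k) ⟩
  sgn (+ 2 * (- k - 1ℤ))        ≡⟨ sgn-even (- k - 1ℤ) ⟩
  - - 1ℤ                        ≡⟨ cong -_ (sgn-odd k) ⟨
  - sgn (+ 2 * k + 1ℤ)          ∎
  where
  open ≡-Reasoning
  flip : ∀ k → - 1ℤ - (+ 2 * k + 1ℤ) ≡ + 2 * (- k - 1ℤ)
  flip = solve-∀

P8-mirror : ∀ r s → P8 (- 1ℤ - r) s ≡ P8 r s
P8-mirror = mirror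
  where
  mirror : ∀ r s → (+ 2 * (- 1ℤ - r) + 1ℤ) * (+ 2 * (- 1ℤ - r) + 1ℤ) - + 2 * (s * s)
                   ≡ (+ 2 * r + 1ℤ) * (+ 2 * r + 1ℤ) - + 2 * (s * s)
  mirror = solve-∀

P8-neg : ∀ r s → P8 r (- s) ≡ P8 r s
P8-neg = neg
  where
  neg : ∀ r s → (+ 2 * r + 1ℤ) * (+ 2 * r + 1ℤ) - + 2 * (- s * - s)
                ≡ (+ 2 * r + 1ℤ) * (+ 2 * r + 1ℤ) - + 2 * (s * s)
  neg = solve-∀

-- 8P(r,s) - r - 1 is a polynomial with nonnegative coefficients in r, r - s and r + s.
P8-lower : ∀ {r s} → 0ℤ ≤ s → s ≤ r → r < P8 r s
P8-lower {r} {s} 0≤s s≤r =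
  ℤP.suc[i]≤j⇒i<j (subst (1ℤ + r ≤_) (sym (expand r s)) (i≤i+nonneg (1ℤ + r) 0≤w))
  where
  w : ℤ
  w = + 2 * (r * r) + + 3 * r + + 2 * ((r - s) * (r + s))
  expand : ∀ r s → (+ 2 * r + 1ℤ) * (+ 2 * r + 1ℤ) - + 2 * (s * s)
                   ≡ (1ℤ + r) + (+ 2 * (r * r) + + 3 * r + + 2 * ((r - s) * (r + s)))
  expand = solve-∀
  0≤r : 0ℤ ≤ r
  0≤r = ℤP.≤-trans 0≤s s≤r
  0≤w : 0ℤ ≤ w
  0≤w = ℤP.+-mono-≤ (ℤP.+-mono-≤ (0≤i*j (0≤+n {2}) (0≤i*j 0≤r 0≤r)) (0≤i*j (0≤+n {3}) 0≤r))
                    (0≤i*j (0≤+n {2}) (0≤i*j (ℤP.i≤j⇒0≤j-i s≤r) (ℤP.+-mono-≤ 0≤r 0≤s)))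

-- (2r+1)² = N + 2s² while ∣2r+1∣ ≥ 2∣r∣ - 1, so ∣r∣ > ∣s∣ + ∣N∣ would make the left side too big.
P8≡⇒∣r∣≤ : ∀ {N} r s → P8 r s ≡ N → ∣ r ∣ ℕ.≤ ∣ s ∣ ℕ.+ ∣ N ∣
P8≡⇒∣r∣≤ {N} r s P8≡N = ℕP.≮⇒≥ λ a<∣r∣ →
  ℕP.<-irrefl refl (ℕP.≤-trans too-big (ℕP.≤-trans (ℕP.*-mono-≤ (2a+1≤t a<∣r∣) (2a+1≤t a<∣r∣)) t²≤))
  where
  u = ∣ s ∣
  V = ∣ N ∣
  a = u ℕ.+ V
  X = + 2 * r + 1ℤ
  t = ∣ X ∣
  t²≤ : t ℕ.* t ℕ.≤ V ℕ.+ 2 ℕ.* (u ℕ.* u)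
  t²≤ = begin
    t ℕ.* t                         ≡⟨ ℤP.abs-* X X ⟨
    ∣ X * X ∣                       ≡⟨ cong ∣_∣ (trans (move X (s * s)) (cong (_+ + 2 * (s * s)) P8≡N)) ⟩
    ∣ N + + 2 * (s * s) ∣           ≤⟨ ℤP.∣i+j∣≤∣i∣+∣j∣ N (+ 2 * (s * s)) ⟩
    V ℕ.+ ∣ + 2 * (s * s) ∣         ≡⟨ cong (V ℕ.+_) (trans (ℤP.abs-* (+ 2) (s * s)) (cong (2 ℕ.*_) (ℤP.abs-* s s))) ⟩
    V ℕ.+ 2 ℕ.* (u ℕ.* u)           ∎
    where
    open ℕP.≤-Reasoning
    move : ∀ X y → X * X ≡ (X * X - + 2 * y) + + 2 * y
    move = solve-∀
  2∣r∣≤1+t : 2 ℕ.* ∣ r ∣ ℕ.≤ suc t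
  2∣r∣≤1+t = begin
    2 ℕ.* ∣ r ∣          ≡⟨ ℤP.abs-* (+ 2) r ⟨
    ∣ + 2 * r ∣          ≡⟨ cong ∣_∣ (drop-one r) ⟩
    ∣ X + - 1ℤ ∣         ≤⟨ ℤP.∣i+j∣≤∣i∣+∣j∣ X (- 1ℤ) ⟩
    t ℕ.+ 1              ≡⟨ ℕP.+-comm t 1 ⟩
    suc t                ∎
    where
    open ℕP.≤-Reasoning
    drop-one : ∀ r → + 2 * r ≡ (+ 2 * r + 1ℤ) + - 1ℤ
    drop-one = solve-∀
  2a+1≤t : a ℕ.< ∣ r ∣ → 2 ℕ.* a ℕ.+ 1 ℕ.≤ t
  2a+1≤t a<∣r∣ = ℕ.s≤s⁻¹ (ℕP.≤-trans (ℕP.≤-reflexive (double-suc a))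
                                    (ℕP.≤-trans (ℕP.*-monoʳ-≤ 2 a<∣r∣) 2∣r∣≤1+t))
    where
    double-suc : ∀ a → suc (2 ℕ.* a ℕ.+ 1) ≡ 2 ℕ.* suc a
    double-suc = ℕ-Solver.solve-∀
  too-big : suc (V ℕ.+ 2 ℕ.* (u ℕ.* u)) ℕ.≤ (2 ℕ.* a ℕ.+ 1) ℕ.* (2 ℕ.* a ℕ.+ 1)
  too-big = ℕP.≤-trans (ℕP.m≤m+n _ _) (ℕP.≤-reflexive (sym (square u V)))
    where
    square : ∀ u V → (2 ℕ.* (u ℕ.+ V) ℕ.+ 1) ℕ.* (2 ℕ.* (u ℕ.+ V) ℕ.+ 1)
                     ≡ suc (V ℕ.+ 2 ℕ.* (u ℕ.* u))
                       ℕ.+ (2 ℕ.* (u ℕ.* u) ℕ.+ 8 ℕ.* (u ℕ.* V) ℕ.+ 4 ℕ.* (V ℕ.* V) ℕ.+ 4 ℕ.* u ℕ.+ 3 ℕ.* V)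
    square = ℕ-Solver.solve-∀

-- term N s r is the coefficient of q^(N/8) in (-1)^r q^P(r,s), and rowTotal N s that of Σ_{r≥s} (-1)^r q^P(r,s),
-- read as -Σ_{r<s} when s < 0 (as in rhsTerm).
module _ (N : ℤ) where

  term : ℤ → ℤ → ℤ
  term s r = sgn r * [ P8 r s ≡ᶻ N ]

  above : ℤ → ℤ → ℤ
  above s r = if ⌊ s ≤? r ⌋ then term s r else 0ℤ

  below : ℤ → ℤ → ℤ
  below s r = if ⌊ r <? s ⌋ then - term s r else 0ℤ

  sided : ℤ → ℤ → ℤ
  sided s r = if ⌊ 0ℤ ≤? s ⌋ then above s r else below s r

  rowTotal : ℤ → ℤ
  rowTotal s = ∑ (range ∣ N ∣) (sided s)

  term-nonzero : ∀ s r → term s r ≢ 0ℤ → P8 r s ≡ N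
  term-nonzero s r with P8 r s ℤ.≟ N
  ... | yes P8≡N = λ _ → P8≡N
  ... | no  _    = λ t≢0 → ⊥-elim (t≢0 (ℤP.*-zeroʳ (sgn r)))

  term-supported : ∀ s → Supported (∣ s ∣ ℕ.+ ∣ N ∣) (term s)
  term-supported s r t≢0 = P8≡⇒∣r∣≤ r s (term-nonzero s r t≢0)

  term-mirror : ∀ s r → term s (- 1ℤ - r) ≡ - term s r
  term-mirror s r = trans (cong₂ _*_ (sgn-reflect r) (cong [_≡ᶻ N ] (P8-mirror r s)))
                          (sym (ℤP.neg-distribˡ-* (sgn r) _))

  above-nonzero : ∀ s r → above s r ≢ 0ℤ → s ≤ r × term s r ≢ 0ℤ
  above-nonzero s r with s ≤? r
  ... | yes s≤r = λ a≢0 → s≤r , a≢0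
  ... | no  _   = λ a≢0 → ⊥-elim (a≢0 refl)

  below-nonzero : ∀ s r → below s r ≢ 0ℤ → r < s × term s r ≢ 0ℤ
  below-nonzero s r with r <? s
  ... | yes r<s = λ b≢0 → r<s , λ t≡0 → b≢0 (cong -_ t≡0)
  ... | no  _   = λ b≢0 → ⊥-elim (b≢0 refl)

  above-supported : ∀ s → Supported (∣ s ∣ ℕ.+ ∣ N ∣) (above s)
  above-supported s r a≢0 = term-supported s r (proj₂ (above-nonzero s r a≢0))

  below-supported : ∀ s → Supported (∣ s ∣ ℕ.+ ∣ N ∣) (below s)
  below-supported s r b≢0 = term-supported s r (proj₂ (below-nonzero s r b≢0))

  -- For s < 0 the reflection (r, s) ↦ (-1-r, -s) reduces to the case s ≥ 0.
  sided-support : ∀ s r → sided s r ≢ 0ℤ → ∣ s ∣ ℕ.≤ ∣ N ∣ × ∣ r ∣ ℕ.≤ ∣ N ∣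
  sided-support (+ a) r a≢0 with above-nonzero (+ a) r a≢0
  ... | +≤+ {n = b} a≤b , t≢0 = ℕP.≤-trans a≤b (ℕP.<⇒≤ b<V) , ℕP.<⇒≤ b<V
    where
    b<V : b ℕ.< ∣ N ∣
    b<V = +n<i⇒n<∣i∣ (subst (+ b <_) (term-nonzero (+ a) (+ b) t≢0) (P8-lower 0≤+n (+≤+ a≤b)))
  sided-support -[1+ a ] r b≢0 with below-nonzero -[1+ a ] r b≢0
  ... | -<- {m = b} a<b , t≢0 = ℕP.<⇒≤ (ℕP.≤-<-trans a<b b<V) , b<V
    where
    reflected : P8 (+ b) (+ suc a) ≡ N
    reflected = trans (trans (P8-neg (+ b) (+ suc a)) (P8-mirror -[1+ b ] -[1+ a ]))
                      (term-nonzero -[1+ a ] -[1+ b ] t≢0)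
    b<V : b ℕ.< ∣ N ∣
    b<V = +n<i⇒n<∣i∣ (subst (+ b <_) reflected (P8-lower 0≤+n (+≤+ a<b)))

  sided-supported : ∀ s → Supported ∣ N ∣ (sided s)
  sided-supported s r x≢0 = proj₂ (sided-support s r x≢0)

  rowTotal-vanish : ∀ s → ∣ N ∣ ℕ.< ∣ s ∣ → rowTotal s ≡ 0ℤ
  rowTotal-vanish s V<∣s∣ =
    ∑-zero (range ∣ N ∣) (λ r → supported-vanish (λ s′ x≢0 → proj₁ (sided-support s′ r x≢0)) s V<∣s∣)

  above≡term+below : ∀ s r → above s r ≡ term s r + below s r
  above≡term+below s r with s ≤? r | r <? s
  ... | yes s≤r | yes r<s = ⊥-elim (ℤP.<⇒≱ r<s s≤r)
  ... | yes _   | no  _   = sym (ℤP.+-identityʳ (term s r))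
  ... | no  _   | yes _   = sym (ℤP.+-inverseʳ (term s r))
  ... | no  s≰r | no  r≮s = ⊥-elim (s≰r (ℤP.≮⇒≥ r≮s))

  ∑-term : ∀ s {K} → ∣ s ∣ ℕ.+ ∣ N ∣ ℕ.< K → ∑ (range K) (term s) ≡ 0ℤ
  ∑-term s {K} B<K = trans (∑-range-antisym K (term s) (term-mirror s))
                           (supported-vanish (term-supported s) (+ K) B<K)

  ∑-above≡∑-below : ∀ s {K} → ∣ s ∣ ℕ.+ ∣ N ∣ ℕ.< K → ∑ (range K) (above s) ≡ ∑ (range K) (below s)
  ∑-above≡∑-below s {K} B<K = begin
    ∑ (range K) (above s)                           ≡⟨ ∑-cong (range K) (above≡term+below s) ⟩
    ∑[ r ∈ range K ] (term s r + below s r)         ≡⟨ ∑-+ (range K) (term s) (below s) ⟩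
    ∑ (range K) (term s) + ∑ (range K) (below s)    ≡⟨ cong (_+ ∑ (range K) (below s)) (∑-term s B<K) ⟩
    0ℤ + ∑ (range K) (below s)                      ≡⟨ ℤP.+-identityˡ _ ⟩
    ∑ (range K) (below s)                           ∎
    where open ≡-Reasoning

  ∑-sided : ∀ s {K} → ∣ N ∣ ℕ.≤ K → ∑ (range K) (sided s) ≡ rowTotal s
  ∑-sided s = ∑-range-stable (sided-supported s)

  ∑-above : ∀ s {K} → ∣ s ∣ ℕ.+ ∣ N ∣ ℕ.< K → ∑ (range K) (above s) ≡ rowTotal s
  ∑-above (+ a)    B<K = ∑-sided (+ a) (ℕP.≤-trans (ℕP.m≤n+m _ a) (ℕP.<⇒≤ B<K))
  ∑-above -[1+ a ] B<K = trans (∑-above≡∑-below -[1+ a ] B<K)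
                               (∑-sided -[1+ a ] (ℕP.≤-trans (ℕP.m≤n+m _ (suc a)) (ℕP.<⇒≤ B<K)))

  ∑-below : ∀ s {K} → ∣ s ∣ ℕ.+ ∣ N ∣ ℕ.< K → ∑ (range K) (below s) ≡ rowTotal s
  ∑-below s B<K = trans (sym (∑-above≡∑-below s B<K)) (∑-above s B<K)

  -- The window must contain the support ∣r∣ ≤ ∣s∣ + ∣N∣ of the row, translated by s.
  ∑-row-shifted : ∀ s {g C K} → Supported (∣ s ∣ ℕ.+ ∣ N ∣) g →
                  (∀ {K′} → ∣ s ∣ ℕ.+ ∣ N ∣ ℕ.< K′ → ∑ (range K′) g ≡ rowTotal s) →
                  ∣ s ∣ ℕ.≤ C → C ℕ.+ ∣ N ∣ ℕ.+ C ℕ.< K → ∑[ m ∈ range K ] g (m + s) ≡ rowTotal s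
  ∑-row-shifted s supp ∑g ∣s∣≤C B<K =
    trans (∑-range-shift supp s (ℕP.<⇒≤ window)) (∑g (ℕP.≤-<-trans (ℕP.m≤m+n _ _) window))
    where
    window : ∣ s ∣ ℕ.+ ∣ N ∣ ℕ.+ ∣ s ∣ ℕ.< _
    window = ℕP.≤-<-trans (ℕP.+-mono-≤ (ℕP.+-monoˡ-≤ ∣ N ∣ ∣s∣≤C) ∣s∣≤C) B<K

  above-vanish : ∀ {s} → + ∣ N ∣ < s → ∀ r → above s r ≡ 0ℤ
  above-vanish {+ a} V<s r = supported-vanish (λ s′ x≢0 → proj₁ (sided-support s′ r x≢0)) (+ a) (+n<i⇒n<∣i∣ V<s)

  below-vanish : ∀ {s} → s < - + ∣ N ∣ → ∀ r → below s r ≡ 0ℤ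
  below-vanish {+ a}      s<-V r = ⊥-elim (ℤP.<⇒≱ s<-V ℤP.neg-≤-pos)
  below-vanish { -[1+ a ]} s<-V r =
    supported-vanish (λ s′ x≢0 → proj₁ (sided-support s′ r x≢0)) -[1+ a ] (i<-n⇒n<∣i∣ -[1+ a ] s<-V)

  above-shift⁺ : ∀ s k → above s (+ k + s) ≡ term s (+ k + s)
  above-shift⁺ s k with s ≤? + k + s
  ... | yes _   = refl
  ... | no  s≰ = ⊥-elim (s≰ (ℤP.i≤j+i s (+ k)))

  above-shift⁻ : ∀ s k → above s (-[1+ k ] + s) ≡ 0ℤ
  above-shift⁻ s k with s ≤? -[1+ k ] + s
  ... | yes s≤ = ⊥-elim (ℤP.<⇒≱ (-[1+n]+i<i k s) s≤)
  ... | no  _  = refl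

  below-shift⁺ : ∀ s k → below s (+ k + s) ≡ 0ℤ
  below-shift⁺ s k with + k + s <? s
  ... | yes <s = ⊥-elim (ℤP.<⇒≱ <s (ℤP.i≤j+i s (+ k)))
  ... | no  _  = refl

  below-shift⁻ : ∀ s k → below s (-[1+ k ] + s) ≡ - term s (-[1+ k ] + s)
  below-shift⁻ s k with -[1+ k ] + s <? s
  ... | yes _  = refl
  ... | no  ≮s = ⊥-elim (≮s (-[1+n]+i<i k s))

  lhsTerm-sign : ∀ ℓ m n → sgn (m + ℓ) * [ lhsExp8 ℓ m n ≡ᶻ N ] ≡ term (+ 2 * n - ℓ) (m + (+ 2 * n - ℓ))
  lhsTerm-sign ℓ m n = cong₂ _*_ (trans (sym (sgn-+2* (m + ℓ) (n - ℓ))) (cong sgn (regroup m n ℓ)))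
                                 (cong [_≡ᶻ N ] (expand ℓ m n))
    where
    regroup : ∀ m n ℓ → m + ℓ + + 2 * (n - ℓ) ≡ m + (+ 2 * n - ℓ)
    regroup = solve-∀
    expand : ∀ ℓ m n →
      (+ 2 * m + + 4 * n - + 2 * ℓ + 1ℤ) * (+ 2 * m + + 4 * n - + 2 * ℓ + 1ℤ) - + 2 * ((+ 2 * n - ℓ) * (+ 2 * n - ℓ))
      ≡ (+ 2 * (m + (+ 2 * n - ℓ)) + 1ℤ) * (+ 2 * (m + (+ 2 * n - ℓ)) + 1ℤ) - + 2 * ((+ 2 * n - ℓ) * (+ 2 * n - ℓ))
    expand = solve-∀

  lhsTerm-row : ∀ ℓ m n → lhsTerm ℓ N m n
                          ≡ (if ⌊ 0ℤ ≤? n ⌋ then above else below) (+ 2 * n - ℓ) (m + (+ 2 * n - ℓ))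
  lhsTerm-row ℓ (+ k)    (+ j)    = trans (lhsTerm-sign ℓ (+ k) (+ j)) (sym (above-shift⁺ (+ 2 * + j - ℓ) k))
  lhsTerm-row ℓ (+ k)    -[1+ j ] = sym (below-shift⁺ (+ 2 * -[1+ j ] - ℓ) k)
  lhsTerm-row ℓ -[1+ k ] (+ j)    = sym (above-shift⁻ (+ 2 * + j - ℓ) k)
  lhsTerm-row ℓ -[1+ k ] -[1+ j ] = trans (cong -_ (lhsTerm-sign ℓ -[1+ k ] -[1+ j ]))
                                          (sym (below-shift⁻ (+ 2 * -[1+ j ] - ℓ) k))

  ∑-above-row : ∀ L s {K} → - + L ≤ s → (∣ N ∣ ℕ.+ L) ℕ.+ ∣ N ∣ ℕ.+ (∣ N ∣ ℕ.+ L) ℕ.< K →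
                ∑[ m ∈ range K ] above s (m + s) ≡ rowTotal s
  ∑-above-row L s {K} -L≤s B<K with s ≤? + ∣ N ∣
  ... | yes s≤V = ∑-row-shifted s (above-supported s) (∑-above s)
                    (subst (∣ s ∣ ℕ.≤_) (ℕP.+-comm L ∣ N ∣) (∣i∣≤a+b s -L≤s s≤V)) B<K
  ... | no  s≰V = trans (∑-zero (range K) (λ m → above-vanish (ℤP.≰⇒> s≰V) (m + s)))
                        (sym (rowTotal-vanish s (+n<i⇒n<∣i∣ (ℤP.≰⇒> s≰V))))

  ∑-below-row : ∀ L s {K} → s ≤ + L → (∣ N ∣ ℕ.+ L) ℕ.+ ∣ N ∣ ℕ.+ (∣ N ∣ ℕ.+ L) ℕ.< K →
                ∑[ m ∈ range K ] below s (m + s) ≡ rowTotal s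
  ∑-below-row L s {K} s≤L B<K with - + ∣ N ∣ ≤? s
  ... | yes -V≤s = ∑-row-shifted s (below-supported s) (∑-below s) (∣i∣≤a+b s -V≤s s≤L) B<K
  ... | no  -V≰s = trans (∑-zero (range K) (λ m → below-vanish (ℤP.≰⇒> -V≰s) (m + s)))
                         (sym (rowTotal-vanish s (i<-n⇒n<∣i∣ s (ℤP.≰⇒> -V≰s))))

-- The truncated coefficients of both sides

lhsThreshold : ℤ → ℤ → ℕ
lhsThreshold ℓ N = suc ((∣ N ∣ ℕ.+ ∣ ℓ ∣) ℕ.+ ∣ N ∣ ℕ.+ (∣ N ∣ ℕ.+ ∣ ℓ ∣))

∑-lhsRow : ∀ ℓ N {K} → lhsThreshold ℓ N ℕ.≤ K → ∀ n →
           ∑[ m ∈ range K ] lhsTerm ℓ N m n ≡ rowTotal N (+ 2 * n - ℓ)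
∑-lhsRow ℓ N {K} K₀≤K n = trans (∑-cong (range K) (λ m → lhsTerm-row N ℓ m n)) (row n)
  where
  row : ∀ n → ∑[ m ∈ range K ] (if ⌊ 0ℤ ≤? n ⌋ then above N else below N) (+ 2 * n - ℓ) (m + (+ 2 * n - ℓ))
              ≡ rowTotal N (+ 2 * n - ℓ)
  row (+ j)    = ∑-above-row N ∣ ℓ ∣ (+ 2 * + j - ℓ) (-∣i∣≤j-i ℓ (0≤i*j (0≤+n {2}) (0≤+n {j}))) K₀≤K
  row -[1+ j ] = ∑-below-row N ∣ ℓ ∣ (+ 2 * -[1+ j ] - ℓ)
                   (j-i≤∣i∣ ℓ (ℤP.*-monoˡ-≤-nonNeg (+ 2) (-≤+ {j} {0}))) K₀≤K

inClass : ℤ → ℤ → Bool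
inClass ℓ s = ⌊ ∣ s - ℓ ∣ ℕ.% 2 ℕ.≟ 0 ⌋

classTotal : ℤ → ℤ → ℤ → ℤ
classTotal ℓ N s = if inClass ℓ s then rowTotal N s else 0ℤ

classTotal-supported : ∀ ℓ N → Supported ∣ N ∣ (classTotal ℓ N)
classTotal-supported ℓ N s x≢0 with inClass ℓ s
... | true  = ℕP.≮⇒≥ (λ V<∣s∣ → x≢0 (rowTotal-vanish N s V<∣s∣))
... | false = ⊥-elim (x≢0 refl)

classTotal-even : ∀ ℓ N n → classTotal ℓ N (+ 2 * n - ℓ) ≡ rowTotal N (+ 2 * n - ℓ)
classTotal-even ℓ N n =
  cong (λ p → if ⌊ p ℕ.≟ 0 ⌋ then rowTotal N (+ 2 * n - ℓ) else 0ℤ)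
       (trans (cong (λ z → ∣ z ∣ ℕ.% 2) (regroup n ℓ)) (∣2k∣%2≡0 (n - ℓ)))
  where
  regroup : ∀ n ℓ → + 2 * n - ℓ - ℓ ≡ + 2 * (n - ℓ)
  regroup = solve-∀

classTotal-odd : ∀ ℓ N n → classTotal ℓ N (+ 2 * n - ℓ + 1ℤ) ≡ 0ℤ
classTotal-odd ℓ N n =
  cong (λ p → if ⌊ p ℕ.≟ 0 ⌋ then rowTotal N (+ 2 * n - ℓ + 1ℤ) else 0ℤ)
       (trans (cong (λ z → ∣ z ∣ ℕ.% 2) (regroup n ℓ)) (∣2k+1∣%2≡1 (n - ℓ)))
  where
  regroup : ∀ n ℓ → + 2 * n - ℓ + 1ℤ - ℓ ≡ + 2 * (n - ℓ) + 1ℤ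
  regroup = solve-∀

∑-rhsColumn : ∀ ℓ N {K} → ∣ N ∣ ℕ.≤ K → ∀ s → ∑[ r ∈ range K ] rhsTerm ℓ N r s ≡ classTotal ℓ N s
∑-rhsColumn ℓ N {K} V≤K s with inClass ℓ s
... | true  = ∑-sided N s V≤K
... | false = ∑-zero (range K) (λ _ → refl)

rhsCoeff-stable : ∀ ℓ N {K} → ∣ N ∣ ℕ.≤ K → rhsCoeff K ℓ N ≡ ∑ (range ∣ N ∣) (classTotal ℓ N)
rhsCoeff-stable ℓ N {K} V≤K = begin
  rhsCoeff K ℓ N                                       ≡⟨ boxSum≡∑∑ K (rhsTerm ℓ N) ⟩
  ∑[ r ∈ range K ] ∑ (range K) (rhsTerm ℓ N r)          ≡⟨ ∑-comm (range K) (range K) (rhsTerm ℓ N) ⟩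
  ∑[ s ∈ range K ] ∑[ r ∈ range K ] rhsTerm ℓ N r s     ≡⟨ ∑-cong (range K) (∑-rhsColumn ℓ N V≤K) ⟩
  ∑ (range K) (classTotal ℓ N)                          ≡⟨ ∑-range-stable (classTotal-supported ℓ N) V≤K ⟩
  ∑ (range ∣ N ∣) (classTotal ℓ N)                      ∎
  where open ≡-Reasoning

lhsCoeff-stable : ∀ ℓ N {K} → lhsThreshold ℓ N ℕ.≤ K → lhsCoeff K ℓ N ≡ ∑ (range ∣ N ∣) (classTotal ℓ N)
lhsCoeff-stable ℓ N {K} K₀≤K = begin
  lhsCoeff K ℓ N                                       ≡⟨ boxSum≡∑∑ K (lhsTerm ℓ N) ⟩
  ∑[ m ∈ range K ] ∑ (range K) (lhsTerm ℓ N m)          ≡⟨ ∑-comm (range K) (range K) (lhsTerm ℓ N) ⟩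
  ∑[ n ∈ range K ] ∑[ m ∈ range K ] lhsTerm ℓ N m n     ≡⟨ ∑-cong (range K) (λ n → trans (∑-lhsRow ℓ N K₀≤K n)
                                                                                       (sym (classTotal-even ℓ N n))) ⟩
  ∑[ n ∈ range K ] classTotal ℓ N (+ 2 * n - ℓ)         ≡⟨ ∑-range-class (classTotal-supported ℓ N) ℓ
                                                                         (classTotal-odd ℓ N) {K} V+L≤2K ⟩
  ∑ (range ∣ N ∣) (classTotal ℓ N)                      ∎
  where
  open ≡-Reasoning
  V+L≤2K : ∣ N ∣ ℕ.+ ∣ ℓ ∣ ℕ.≤ K ℕ.+ K
  V+L≤2K = ℕP.≤-trans (ℕP.m≤n⇒m≤n+o _ (ℕP.m≤m+n _ _))
             (ℕP.≤-trans (ℕP.n≤1+n _) (ℕP.≤-trans K₀≤K (ℕP.m≤m+n K K)))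

lemma4p2 : (ℓ N : ℤ) → ∃ λ (c : ℤ) → ∃ λ (K₀ : ℕ) → (K : ℕ) → K₀ ℕ.≤ K →
             (lhsCoeff K ℓ N ≡ c) × (rhsCoeff K ℓ N ≡ c)
lemma4p2 ℓ N = ∑ (range ∣ N ∣) (classTotal ℓ N) , lhsThreshold ℓ N , λ K K₀≤K →
  lhsCoeff-stable ℓ N K₀≤K , rhsCoeff-stable ℓ N (ℕP.≤-trans V≤K₀ K₀≤K)
  where
  V≤K₀ : ∣ N ∣ ℕ.≤ lhsThreshold ℓ N
  V≤K₀ = ℕP.≤-trans (ℕP.m≤m+n _ _) (ℕP.m≤n⇒m≤1+n (ℕP.m≤n⇒m≤n+o _ (ℕP.m≤m+n _ _)))
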